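{- Let $\omega\in\widetilde{\mathfrak S}_n$ be a dominant affine permutation. Then $\alpha^{ -1}(\gamma(\omega^*))$ is the conjugate partition of $\alpha^{ -1}(\gamma(\omega))$.
   Context: $\widetilde{\mathfrak S}_n$ is the group of bijections $\omega:\mathbb Z\to\mathbb Z$ with $\omega(i+n)=\omega(i)+n$ and $\omega(1)+\dots+\omega(n)=n(n+1)/2$; $\omega$ is dominant if $\omega^{ -1}(1)<\dots<\omega^{ -1}(n)$. The involution $\omega^*$ is given by $\omega^*(i)=1-\omega(1-i)$; it preserves dominance. For dominant $\omega$, $\gamma(\omega)=\{z\in\mathbb Z:\omega(z)\le0\}$. For a partition $\kappa$, $\alpha(\kappa)=\{\kappa_i+1-i:i\ge1\}$ (with $\kappa_i=0$ for $i$ larger than the length of $\kappa$); $\alpha$ is a bijection from $n$-cores onto balanced $n$-flush abaci, $\gamma$ is a bijection from dominant affine permutations onto balanced $n$-flush abaci, and $\alpha^{ -1}(\gamma(\omega))$ denotes the unique partition $\kappa$ with $\alpha(\kappa)=\gamma(\omega)$. (An abacus is a set $A\subseteq\mathbb Z$ containing all sufficiently small integers and no sufficiently large ones; it is balanced if the number of positive elements of $A$ equals the number of non-positive integers not in $A$, and $n$-flush if $z\in A$ implies $z-n\in A$.) -}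

module Defs where

open import Data.Nat as ℕ using (ℕ; zero; suc)
open import Data.Integer as ℤ using (ℤ; +_; _+_; _-_; _*_; _≤_; _<_)
open import Data.List as List using (List; []; _∷_; length; filter; applyUpTo)
open import Data.List.Relation.Unary.All using (All)
open import Data.List.Relation.Unary.Linked using (Linked)
open import Data.Product using (Σ; _×_; ∃; _,_)
open import Relation.Binary.PropositionalEquality using (_≡_)
open import Function.Bundles using (_⇔_)

sumTo : (ℤ → ℤ) → ℕ → ℤ
sumTo ω zero = + 0
sumTo ω (suc k) = sumTo ω k + ω (+ suc k)

record IsAffinePerm (n : ℕ) (ω : ℤ → ℤ) : Set where
  field
    injective  : ∀ i j → ω i ≡ ω j → i ≡ j
    surjective : ∀ k → ∃ λ i → ω i ≡ k
    periodic   : ∀ i → ω (i + + n) ≡ ω i + + n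
    -- ω(1)+…+ω(n) = n(n+1)/2, written with the factor 2 cleared
    sumCond    : + 2 * sumTo ω n ≡ + n * + (suc n)

-- dominant: ω⁻¹(1) < … < ω⁻¹(n), i.e. ω⁻¹ is increasing on {1,…,n}
IsDominant : ℕ → (ℤ → ℤ) → Set
IsDominant n ω = ∀ i j → + 1 ≤ ω i → ω i < ω j → ω j ≤ + n → i < j

star : (ℤ → ℤ) → (ℤ → ℤ)
star ω i = + 1 - ω (+ 1 - i)

Subset : Set₁
Subset = ℤ → Set

_≐_ : Subset → Subset → Set
A ≐ B = ∀ z → A z ⇔ B z

γ : (ℤ → ℤ) → Subset
γ ω z = ω z ≤ + 0

IsPartition : List ℕ → Set
IsPartition κ = All (λ k → 1 ℕ.≤ k) κ × Linked ℕ._≥_ κ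

-- κ_i (1-based), with κ_i = 0 beyond the length
part : List ℕ → ℕ → ℕ
part []       _             = 0
part (k ∷ κ)  zero          = 0
part (k ∷ κ)  (suc zero)    = k
part (k ∷ κ)  (suc (suc i)) = part κ (suc i)

α : List ℕ → Subset
α κ z = Σ ℕ λ i → (1 ℕ.≤ i) × (z ≡ + part κ i + + 1 - + i)

-- conjugate partition: κ'_j = #{ i : κ_i ≥ j } for j = 1, …, κ_1
conjugate : List ℕ → List ℕ
conjugate []      = []
conjugate (k ∷ κ) = applyUpTo (λ j → length (filter (suc j ℕ.≤?_) (k ∷ κ))) k

-- Only the relation γ(ω*) = { z : 1 - z ∉ γ(ω) } is used. For this, view α(κ) as the Maya diagram { κᵢ + 1 - i } of the sequence κ.
-- If p and q are Galois conjugate (j ≤ pᵢ ⇔ i ≤ qⱼ), the diagrams of q and of p reflected are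
-- disjoint (adding the two equations gives i + j = pᵢ + qⱼ + 1, impossible on either side of
-- the Galois connection) and cover ℤ (walk down the strictly decreasing values qⱼ + 1 - j
-- until they pass z; at the crossing p takes the value that puts 1 - z into the diagram of p).
-- Since the Maya diagram of an antitone sequence is the image of a strictly decreasing
-- sequence, it determines the sequence, and a partition is determined by its parts.
module Submission where

open import Defs
open import Data.Nat using (ℕ; _≤_)
open import Data.List using (List)
open import Data.Integer using (ℤ)
open import Relation.Binary.PropositionalEquality using (_≡_)

open import Data.Nat using (zero; suc; _+_; _∸_; _<_; _≥_; z≤n; s≤s; _≤?_; _<?_)
open import Data.Nat.Properties
import Data.Nat.Tactic.RingSolver as ℕ-Solver
open import Data.Integer as ℤ using (+_; -[1+_])
import Data.Integer.Properties as ℤ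
import Data.Integer.Tactic.RingSolver as ℤ-Solver
open import Data.List using ([]; _∷_; length; filter; applyUpTo)
open import Data.List.Properties using (filter-accept; filter-reject)
open import Data.List.Relation.Unary.All using (All; []; _∷_)
open import Data.List.Relation.Unary.All.Properties using (applyUpTo⁺₁)
open import Data.List.Relation.Unary.Linked using (Linked; []; [-]; _∷_)
open import Data.Product using (Σ; ∃; _×_; _,_; proj₂)
open import Data.Sum using (_⊎_; inj₁; inj₂; [_,_]′)
open import Data.Empty using (⊥-elim)
open import Function using (id; _∘_)
open import Function.Bundles using (_⇔_; mk⇔; Equivalence)
open import Relation.Binary using (Rel; tri<; tri≈; tri>)
open import Relation.Binary.Structures using (IsStrictPartialOrder)
open import Relation.Binary.PropositionalEquality
  using (_≢_; refl; sym; trans; cong; cong₂; subst; subst₂; module ≡-Reasoning)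
open import Relation.Nullary using (¬_; yes; no; contradiction; contraposition)
open import Relation.Unary using (Decidable)

open Equivalence

private
  variable
    p q p′ : ℕ → ℕ
    k : ℕ
    κ μ ν : List ℕ

-- Sequences are only ever read at positive indices, matching `part`, whose value at 0 is junk.
Antitone : (ℕ → ℕ) → Set
Antitone p = ∀ i → p (suc (suc i)) ≤ p (suc i)

record Conjugate (p q : ℕ → ℕ) : Set where
  constructor galois
  field
    ≤⇔≤ : ∀ i j → suc j ≤ p (suc i) ⇔ suc i ≤ q (suc j)

open Conjugate

conjugate-sym : Conjugate p q → Conjugate q p
conjugate-sym c = galois λ i j → mk⇔ (from (≤⇔≤ c j i)) (to (≤⇔≤ c j i))

conjugate-≤ : Conjugate p q → ∀ i t → ¬ suc i ≤ q (suc t) → p (suc i) ≤ t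
conjugate-≤ c i t i≰q = ≤-pred (≰⇒> (contraposition (to (≤⇔≤ c i t)) i≰q))

conjugate-antitone : Conjugate p q → Antitone q
conjugate-antitone {p} {q} c j with q (suc (suc j)) in eq
... | zero  = z≤n
... | suc i = to (≤⇔≤ c i j) (<⇒≤ (from (≤⇔≤ c i (suc j)) (subst (suc i ≤_) (sym eq) ≤-refl)))

part-≤-head : Linked _≥_ (k ∷ κ) → ∀ i → part κ i ≤ k
part-≤-head [-]                   i             = z≤n
part-≤-head (k≥k′ ∷ κ↓)           zero          = z≤n
part-≤-head (k≥k′ ∷ κ↓)           (suc zero)    = k≥k′
part-≤-head {κ = _ ∷ κ} (k≥k′ ∷ κ↓) (suc (suc i)) = ≤-trans (part-≤-head κ↓ (suc i)) k≥k′

linked-tail : Linked _≥_ (k ∷ κ) → Linked _≥_ κ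
linked-tail [-]      = []
linked-tail (_ ∷ κ↓) = κ↓

part-antitone : Linked _≥_ κ → Antitone (part κ)
part-antitone {[]}    κ↓ i       = z≤n
part-antitone {_ ∷ κ} κ↓ zero    = part-≤-head κ↓ 1
part-antitone {_ ∷ κ} κ↓ (suc i) = part-antitone (linked-tail κ↓) i

part-injective : All (1 ≤_) μ → All (1 ≤_) ν → (∀ i → part μ (suc i) ≡ part ν (suc i)) → μ ≡ ν
part-injective []          []          _ = refl
part-injective []          (ν₁>0 ∷ _)  e = contradiction (e 0) (<⇒≢ ν₁>0)
part-injective (μ₁>0 ∷ _)  []          e = contradiction (e 0) (>⇒≢ μ₁>0)
part-injective (_ ∷ μ⁺)    (_ ∷ ν⁺)    e = cong₂ _∷_ (e 0) (part-injective μ⁺ ν⁺ (e ∘ suc))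

part-applyUpTo : ∀ f {k j} → j < k → part (applyUpTo f k) (suc j) ≡ f j
part-applyUpTo f {suc k} {zero}  _           = refl
part-applyUpTo f {suc k} {suc j} (s≤s j<k) = part-applyUpTo (f ∘ suc) j<k

part-applyUpTo-beyond : ∀ f {k j} → k ≤ j → part (applyUpTo f k) (suc j) ≡ 0
part-applyUpTo-beyond f {zero}  _         = refl
part-applyUpTo-beyond f {suc k} (s≤s k≤j) = part-applyUpTo-beyond (f ∘ suc) k≤j

count≥ : ℕ → List ℕ → ℕ
count≥ j = length ∘ filter (j ≤?_)

count≥-accept : ∀ {j k} κ → j ≤ k → count≥ j (k ∷ κ) ≡ suc (count≥ j κ)
count≥-accept κ j≤k = cong length (filter-accept (_ ≤?_) j≤k)

count≥-reject : ∀ {j k} κ → ¬ j ≤ k → count≥ j (k ∷ κ) ≡ count≥ j κ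
count≥-reject κ j≰k = cong length (filter-reject (_ ≤?_) j≰k)

count≥-above-head : ∀ {j} → Linked _≥_ (k ∷ κ) → k < j → count≥ j κ ≡ 0
count≥-above-head {κ = []}    _          _   = refl
count≥-above-head {κ = k′ ∷ κ} (k≥k′ ∷ κ↓) k<j =
  trans (count≥-reject κ (<⇒≱ (≤-<-trans k≥k′ k<j))) (count≥-above-head κ↓ (≤-<-trans k≥k′ k<j))

part-conjugate≡count≥ : Linked _≥_ κ → ∀ j → part (conjugate κ) (suc j) ≡ count≥ (suc j) κ
part-conjugate≡count≥ {[]}    _  j = refl
part-conjugate≡count≥ {k ∷ κ} κ↓ j with j <? k
... | yes j<k = part-applyUpTo _ j<k
... | no  j≮k = begin
  part (conjugate (k ∷ κ)) (suc j) ≡⟨ part-applyUpTo-beyond _ (≮⇒≥ j≮k) ⟩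
  0                                ≡⟨ sym (count≥-above-head κ↓ (s≤s (≮⇒≥ j≮k))) ⟩
  count≥ (suc j) κ                 ≡⟨ sym (count≥-reject κ j≮k) ⟩
  count≥ (suc j) (k ∷ κ)           ∎
  where open ≡-Reasoning

conjugate-positive : ∀ κ → All (1 ≤_) (conjugate κ)
conjugate-positive []      = []
conjugate-positive (k ∷ κ) =
  applyUpTo⁺₁ _ k (λ j<k → subst (1 ≤_) (sym (count≥-accept κ j<k)) (s≤s z≤n))

Conjugate-part-count≥ : Linked _≥_ κ → Conjugate (part κ) (λ j → count≥ j κ)
Conjugate-part-count≥ κ↓ = galois λ i j → mk⇔ (⇒ j κ↓ i) (⇐ j κ↓ i)
  where
  ⇒ : ∀ j → Linked _≥_ κ → ∀ i → suc j ≤ part κ (suc i) → suc i ≤ count≥ (suc j) κ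
  ⇒ {k ∷ κ} j κ↓ zero    j<k = subst (1 ≤_) (sym (count≥-accept κ j<k)) (s≤s z≤n)
  ⇒ {k ∷ κ} j κ↓ (suc i) j<κᵢ =
    subst (suc (suc i) ≤_) (sym (count≥-accept κ (≤-trans j<κᵢ (part-≤-head κ↓ (suc i)))))
      (s≤s (⇒ j (linked-tail κ↓) i j<κᵢ))
  ⇐ : ∀ j → Linked _≥_ κ → ∀ i → suc i ≤ count≥ (suc j) κ → suc j ≤ part κ (suc i)
  ⇐ {k ∷ κ} j κ↓ i i<c with suc j ≤? k
  ⇐ {k ∷ κ} j κ↓ zero    i<c | yes j<k = j<k
  ⇐ {k ∷ κ} j κ↓ (suc i) i<c | yes j<k =
    ⇐ j (linked-tail κ↓) i (≤-pred (subst (suc (suc i) ≤_) (count≥-accept κ j<k) i<c))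
  ⇐ {k ∷ κ} j κ↓ i i<c | no j≮k
    rewrite count≥-reject κ j≮k | count≥-above-head κ↓ (≰⇒> j≮k) with () ← i<c

Conjugate-part-conjugate : Linked _≥_ κ → Conjugate (part κ) (part (conjugate κ))
Conjugate-part-conjugate {κ} κ↓ = galois λ i j →
  subst (λ c → suc j ≤ part κ (suc i) ⇔ suc i ≤ c) (sym (part-conjugate≡count≥ κ↓ j))
    (≤⇔≤ (Conjugate-part-count≥ κ↓) i j)

crossing : ∀ {P : ℕ → Set} → Decidable P → ∀ n → ¬ P n → ¬ P 0 ⊎ ∃ λ j → P j × ¬ P (suc j)
crossing P? zero    ¬P₀   = inj₁ ¬P₀
crossing P? (suc n) ¬Pₙ₊₁ with P? n
... | yes Pₙ = inj₂ (n , Pₙ , ¬Pₙ₊₁)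
... | no ¬Pₙ = crossing P? n ¬Pₙ

-- α κ is definitionally maya (part κ).
maya : (ℕ → ℕ) → Subset
maya p z = Σ ℕ λ i → (1 ≤ i) × (z ≡ + p i ℤ.+ + 1 ℤ.- + i)

InMaya : (ℕ → ℕ) → ℕ → ℕ → Set
InMaya p a b = ∃ λ i → a + i ≡ p (suc i) + b

mayaSeq : (ℕ → ℕ) → ℕ → ℤ
mayaSeq p i = + p (suc i) ℤ.- + i

maya⇔image : ∀ {z} → maya p z ⇔ ∃ λ i → z ≡ mayaSeq p i
maya⇔image {p} = mk⇔ (λ { (suc i , _ , e) → i , trans e (shift (p (suc i)) i) })
                     (λ (i , e) → suc i , s≤s z≤n , trans e (sym (shift (p (suc i)) i)))
  where
  shift : ∀ x i → + x ℤ.+ + 1 ℤ.- + suc i ≡ + x ℤ.- + i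
  shift x i = solution (+ x) (+ i)
    where
    solution : ∀ x i → x ℤ.+ + 1 ℤ.- (+ 1 ℤ.+ i) ≡ x ℤ.- i
    solution = ℤ-Solver.solve-∀

-≡-⇔+≡+ : ∀ {a b c d} → + a ℤ.- + b ≡ + c ℤ.- + d ⇔ a + d ≡ c + b
-≡-⇔+≡+ {a} {b} {c} {d} = mk⇔ ⇒ ⇐
  where
  open ≡-Reasoning
  ⇒ : + a ℤ.- + b ≡ + c ℤ.- + d → a + d ≡ c + b
  ⇒ e = ℤ.+-injective (begin
    + (a + d)                              ≡⟨ ℤ.pos-+ a d ⟩
    + a ℤ.+ + d                            ≡⟨ regroup (+ a) (+ b) (+ d) ⟩
    (+ a ℤ.- + b) ℤ.+ (+ b ℤ.+ + d)        ≡⟨ cong (ℤ._+ (+ b ℤ.+ + d)) e ⟩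
    (+ c ℤ.- + d) ℤ.+ (+ b ℤ.+ + d)        ≡⟨ regroup′ (+ c) (+ d) (+ b) ⟩
    + c ℤ.+ + b                            ≡⟨ ℤ.pos-+ c b ⟨
    + (c + b)                              ∎)
    where
    regroup : ∀ x y w → x ℤ.+ w ≡ (x ℤ.- y) ℤ.+ (y ℤ.+ w)
    regroup = ℤ-Solver.solve-∀
    regroup′ : ∀ x y w → (x ℤ.- y) ℤ.+ (w ℤ.+ y) ≡ x ℤ.+ w
    regroup′ = ℤ-Solver.solve-∀
  ⇐ : a + d ≡ c + b → + a ℤ.- + b ≡ + c ℤ.- + d
  ⇐ e = begin
    + a ℤ.- + b                            ≡⟨ regroup (+ a) (+ b) (+ d) ⟩
    (+ a ℤ.+ + d) ℤ.- (+ b ℤ.+ + d)        ≡⟨ cong (ℤ._- (+ b ℤ.+ + d)) (trans (sym (ℤ.pos-+ a d)) (cong +_ e)) ⟩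
    + (c + b) ℤ.- (+ b ℤ.+ + d)            ≡⟨ cong (ℤ._- (+ b ℤ.+ + d)) (ℤ.pos-+ c b) ⟩
    (+ c ℤ.+ + b) ℤ.- (+ b ℤ.+ + d)        ≡⟨ regroup′ (+ c) (+ b) (+ d) ⟩
    + c ℤ.- + d                            ∎
    where
    regroup : ∀ x y w → x ℤ.- y ≡ (x ℤ.+ w) ℤ.- (y ℤ.+ w)
    regroup = ℤ-Solver.solve-∀
    regroup′ : ∀ x y w → (x ℤ.+ y) ℤ.- (y ℤ.+ w) ≡ x ℤ.- w
    regroup′ = ℤ-Solver.solve-∀

maya-ℕ : ∀ {a b} → maya p (+ a ℤ.- + b) ⇔ InMaya p a b
maya-ℕ {p} {a} {b} = mk⇔
  (λ m → let (i , e) = to maya⇔image m in i , to (-≡-⇔+≡+ {a} {b} {p (suc i)} {i}) e)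
  (λ (i , e) → from maya⇔image (i , from (-≡-⇔+≡+ {a} {b} {p (suc i)} {i}) e))

conjugate-disjoint : ∀ {m k} → Conjugate p q → InMaya q m k → ¬ InMaya p (suc k) m
conjugate-disjoint {p} {q} {m} {k} c (j , eq) (i , ep) = sum≢ sum
  where
  sum : suc (j + i) ≡ p (suc i) + q (suc j)
  sum = +-cancelˡ-≡ (m + k) _ _ (begin
    m + k + suc (j + i)               ≡⟨ regroup m k j i ⟩
    (m + j) + (suc k + i)             ≡⟨ cong₂ _+_ eq ep ⟩
    (q (suc j) + k) + (p (suc i) + m) ≡⟨ regroup′ (q (suc j)) k (p (suc i)) m ⟩
    m + k + (p (suc i) + q (suc j))   ∎)
    where
    open ≡-Reasoning
    regroup : ∀ m k j i → m + k + (1 + (j + i)) ≡ (m + j) + ((1 + k) + i)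
    regroup = ℕ-Solver.solve-∀
    regroup′ : ∀ y k x m → (y + k) + (x + m) ≡ m + k + (x + y)
    regroup′ = ℕ-Solver.solve-∀
  sum≢ : suc (j + i) ≢ p (suc i) + q (suc j)
  sum≢ with suc j ≤? p (suc i)
  ... | yes j<pᵢ = <⇒≢ (<-≤-trans (s≤s (≤-reflexive (sym (+-suc j i))))
                                  (+-mono-≤ j<pᵢ (to (≤⇔≤ c i j) j<pᵢ)))
  ... | no  j≮pᵢ = >⇒≢ (s≤s (+-mono-≤ (≤-pred (≰⇒> j≮pᵢ)) (conjugate-≤ (conjugate-sym c) j i j≮pᵢ)))

-- Walk down from j = 0 while z = m - k stays at or below qⱼ₊₁ - j; this fails for large j.
conjugate-cover : Conjugate p q → ∀ m k → InMaya q m k ⊎ InMaya p (suc k) m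
conjugate-cover {p} {q} c m k =
  [ inj₂ ∘ from-start , from-crossing ]′ (crossing (λ j → m + j ≤? q (suc j) + k) n ¬below-n)
  where
  Below : ℕ → Set
  Below j = m + j ≤ q (suc j) + k

  n : ℕ
  n = p 1 + suc k

  ¬below-n : ¬ Below n
  ¬below-n below = <⇒≱ (≤-trans (m≤n+m (suc k) (p 1)) (m≤n+m n m)) (≤-trans below (+-monoˡ-≤ k qₙ≤0))
    where
    qₙ≤0 : q (suc n) ≤ 0
    qₙ≤0 = conjugate-≤ (conjugate-sym c) n 0 (≤⇒≯ (m≤m+n (p 1) (suc k)))

  from-start : ¬ Below 0 → InMaya p (suc k) m
  from-start ¬below₀ = i , trans ki (cong (_+ m) (sym pᵢ≡0))
    where
    q₁+k<m : q 1 + k < m + 0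
    q₁+k<m = ≰⇒> ¬below₀
    i : ℕ
    i = m ∸ suc k
    ki : suc k + i ≡ m
    ki = m+[n∸m]≡n (subst (suc k ≤_) (+-identityʳ m) (≤-<-trans (m≤n+m k (q 1)) q₁+k<m))
    pᵢ≡0 : p (suc i) ≡ 0
    pᵢ≡0 = n≤0⇒n≡0 (conjugate-≤ c i 0 λ i<q₁ → <⇒≱ q₁+k<m
      (subst₂ _≤_ (trans (trans (+-suc k i) ki) (sym (+-identityʳ m))) (+-comm k (q 1)) (+-monoʳ-≤ k i<q₁)))

  from-crossing : (∃ λ j → Below j × ¬ Below (suc j)) → InMaya q m k ⊎ InMaya p (suc k) m
  from-crossing (j , below , ¬below′) with m≤n⇒m<n∨m≡n below
  ... | inj₂ on  = inj₁ (j , on)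
  ... | inj₁ off = inj₂ (i , hit)
    where
    k≤m+j : k ≤ m + j
    k≤m+j = ≤-pred (subst (k <_) (+-suc m j) (≤-<-trans (m≤n+m k _) (≰⇒> ¬below′)))
    i : ℕ
    i = (m + j) ∸ k
    ki : k + i ≡ m + j
    ki = m+[n∸m]≡n k≤m+j
    k+1+i : k + suc i ≡ m + suc j
    k+1+i = trans (+-suc k i) (trans (cong suc ki) (sym (+-suc m j)))
    i<⇔ : ∀ x → suc i ≤ x ⇔ m + suc j ≤ x + k
    i<⇔ x = mk⇔ (λ h → subst₂ _≤_ k+1+i (+-comm k x) (+-monoʳ-≤ k h))
                (λ h → +-cancelˡ-≤ k _ _ (subst₂ _≤_ (sym k+1+i) (+-comm x k) h))
    pᵢ≡ : p (suc i) ≡ suc j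
    pᵢ≡ = ≤-antisym (conjugate-≤ c i (suc j) (contraposition (to (i<⇔ _)) ¬below′))
                    (from (≤⇔≤ c i j) (from (i<⇔ _) (subst (_≤ q (suc j) + k) (sym (+-suc m j)) off)))
    hit : suc k + i ≡ p (suc i) + m
    hit = begin
      suc k + i      ≡⟨ cong suc ki ⟩
      suc (m + j)    ≡⟨ +-suc m j ⟨
      m + suc j      ≡⟨ +-comm m (suc j) ⟩
      suc j + m      ≡⟨ cong (_+ m) pᵢ≡ ⟨
      p (suc i) + m  ∎
      where open ≡-Reasoning

ℤ-difference : ∀ z → ∃ λ m → ∃ λ k → z ≡ + m ℤ.- + k
ℤ-difference (+ m)    = m , 0 , sym (ℤ.+-identityʳ (+ m))
ℤ-difference -[1+ k ] = 0 , suc k , refl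

maya-conjugate : Conjugate p q → ∀ z → maya q z ⇔ (¬ maya p (+ 1 ℤ.- z))
maya-conjugate {p} {q} c z with ℤ-difference z
... | m , k , refl = mk⇔
  (λ q∋z → conjugate-disjoint c (to q∋⇔ q∋z) ∘ to p∋⇔ ∘ subst (maya p) (reflect m k))
  (λ p∌1-z → from q∋⇔ ([ id , ⊥-elim ∘ p∌1-z ∘ subst (maya p) (sym (reflect m k)) ∘ from p∋⇔ ]′
                          (conjugate-cover c m k)))
  where
  q∋⇔ : maya q (+ m ℤ.- + k) ⇔ InMaya q m k
  q∋⇔ = maya-ℕ
  p∋⇔ : maya p (+ suc k ℤ.- + m) ⇔ InMaya p (suc k) m
  p∋⇔ = maya-ℕ
  reflect : ∀ m k → + 1 ℤ.- (+ m ℤ.- + k) ≡ + suc k ℤ.- + m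
  reflect m k = solution (+ m) (+ k)
    where
    solution : ∀ m k → + 1 ℤ.- (m ℤ.- k) ≡ (+ 1 ℤ.+ k) ℤ.- m
    solution = ℤ-Solver.solve-∀

module _ {a ℓ} {A : Set a} {_≺_ : Rel A ℓ} (≺-spo : IsStrictPartialOrder _≡_ _≺_) where
  open IsStrictPartialOrder ≺-spo using (irrefl; asym) renaming (trans to ≺-trans)

  StrictlyDecreasing : (ℕ → A) → Set ℓ
  StrictlyDecreasing f = ∀ i → f (suc i) ≺ f i

  decreasing-≺ : ∀ {f} → StrictlyDecreasing f → ∀ {i j} → i < j → f j ≺ f i
  decreasing-≺ f↓ {i} {suc j} i<1+j with m<1+n⇒m<n∨m≡n i<1+j
  ... | inj₁ i<j  = ≺-trans (f↓ j) (decreasing-≺ f↓ i<j)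
  ... | inj₂ refl = f↓ i

  agrees-or-below : ∀ {f g} → StrictlyDecreasing f → StrictlyDecreasing g → ∀ {n m} →
                    (∀ k → k < n → g k ≡ f k) → f n ≡ g m → f n ≡ g n ⊎ f n ≺ g n
  agrees-or-below f↓ g↓ {n} {m} agree fₙ≡gₘ with <-cmp m n
  ... | tri< m<n _ _  = ⊥-elim (irrefl (trans fₙ≡gₘ (agree m m<n)) (decreasing-≺ f↓ m<n))
  ... | tri≈ _ refl _ = inj₁ fₙ≡gₘ
  ... | tri> _ _ n<m  = inj₂ (subst (_≺ _) (sym fₙ≡gₘ) (decreasing-≺ g↓ n<m))

  decreasing-same-image⇒≡ : ∀ {f g} → StrictlyDecreasing f → StrictlyDecreasing g →
                            (∀ i → ∃ λ j → f i ≡ g j) → (∀ j → ∃ λ i → g j ≡ f i) → ∀ n → f n ≡ g n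
  decreasing-same-image⇒≡ {f} {g} f↓ g↓ f⊆g g⊆f n = agree-below (suc n) n ≤-refl
    where
    agree-below : ∀ n k → k < n → f k ≡ g k
    agree-below (suc n) k k<1+n with m<1+n⇒m<n∨m≡n k<1+n
    ... | inj₁ k<n  = agree-below n k k<n
    ... | inj₂ refl with agrees-or-below f↓ g↓ (λ k k<n → sym (agree-below n k k<n)) (proj₂ (f⊆g n))
                       | agrees-or-below g↓ f↓ (agree-below n) (proj₂ (g⊆f n))
    ...   | inj₁ fₙ≡gₙ | _          = fₙ≡gₙ
    ...   | inj₂ _     | inj₁ gₙ≡fₙ = sym gₙ≡fₙ
    ...   | inj₂ fₙ≺gₙ | inj₂ gₙ≺fₙ = ⊥-elim (asym fₙ≺gₙ gₙ≺fₙ)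

mayaSeq-decreasing : Antitone p → StrictlyDecreasing ℤ.<-isStrictPartialOrder (mayaSeq p)
mayaSeq-decreasing p↓ i = ℤ.+-mono-≤-< (ℤ.+≤+ (p↓ i)) (ℤ.neg-mono-< (ℤ.+<+ (n<1+n i)))

maya-injective : Antitone p → Antitone p′ → maya p ≐ maya p′ → ∀ i → p (suc i) ≡ p′ (suc i)
maya-injective {p} {p′} p↓ p′↓ same i = +-cancelʳ-≡ i _ _ (to (-≡-⇔+≡+ {p (suc i)} {i} {p′ (suc i)} {i})
  (decreasing-same-image⇒≡ ℤ.<-isStrictPartialOrder (mayaSeq-decreasing {p} p↓) (mayaSeq-decreasing {p′} p′↓)
    (image (to ∘ same)) (image (from ∘ same)) i))
  where
  image : ∀ {p p′} → (∀ z → maya p z → maya p′ z) → ∀ i → ∃ λ j → mayaSeq p i ≡ mayaSeq p′ j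
  image p⊆p′ i = to maya⇔image (p⊆p′ _ (from maya⇔image (i , refl)))

1-x≤0⇔x≰0 : ∀ x → + 1 ℤ.- x ℤ.≤ + 0 ⇔ (¬ x ℤ.≤ + 0)
1-x≤0⇔x≰0 x = mk⇔
  (λ 1-x≤0 x≤0 → contradiction (ℤ.≤-trans {+ 1} (ℤ.i-j≤0⇒i≤j 1-x≤0) x≤0) λ { (ℤ.+≤+ ()) })
  (λ x≰0 → ℤ.i≤j⇒i-j≤0 (ℤ.i<j⇒suc[i]≤j (ℤ.≰⇒> x≰0)))

γ-star : ∀ ω z → γ (star ω) z ⇔ (¬ γ ω (+ 1 ℤ.- z))
γ-star ω z = 1-x≤0⇔x≰0 (ω (+ 1 ℤ.- z))

proposition2p17 : (n : ℕ) → 1 ≤ n → (ω : ℤ → ℤ) → IsAffinePerm n ω → IsDominant n ω →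
    (κ λ' : List ℕ) → IsPartition κ → IsPartition λ' →
    α κ ≐ γ ω → α λ' ≐ γ (star ω) → λ' ≡ conjugate κ
proposition2p17 _ _ ω _ _ κ λ' (_ , κ↓) (λ'⁺ , λ'↓) α≐γ α'≐γ* =
  part-injective λ'⁺ (conjugate-positive κ)
    (maya-injective (part-antitone λ'↓) (conjugate-antitone κ-κ′) same)
  where
  κ-κ′ : Conjugate (part κ) (part (conjugate κ))
  κ-κ′ = Conjugate-part-conjugate κ↓
  same : α λ' ≐ maya (part (conjugate κ))
  same z = mk⇔
    (λ λ'∋z → from (maya-conjugate κ-κ′ z)
                (contraposition (to (α≐γ _)) (to (γ-star ω z) (to (α'≐γ* z) λ'∋z))))
    (λ κ′∋z → from (α'≐γ* z)
                (from (γ-star ω z) (contraposition (from (α≐γ _)) (to (maya-conjugate κ-κ′ z) κ′∋z))))
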